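{- Let $\alpha_G>1$ and let $G$ be the weighted grid DAG described in the context. Let $s=(i,j)$ be a vertex of $G$ and $t=(k,j+1)$ with $k<i$. Then the shortest $s$-$t$ path $P$ uses a series of vertical edges followed by exactly one horizontal edge, and $P$ is the only $\alpha_G$-approximate shortest $s$-$t$ path in $G$.
   Context: Let $n$ be a perfect square. $G$ is the $\sqrt{n}\times\sqrt{n}$ grid with vertices $(r,c)$, $0\le r,c\le\sqrt{n}-1$ ($r$ = row, $c$ = column, $(0,0)$ the top-left corner). Horizontal edges are directed to the right, $(r,c)\to(r,c+1)$, and have weight $1$. Vertical edges are directed upward, $(r,c)\to(r-1,c)$, and a vertical edge in column $c$ has weight $(\alpha_G\sqrt{n})^{2c}$. A path from $s$ to $t$ is an $\alpha$-approximate shortest path if its weight is at most $\alpha$ times the $s$-$t$ distance.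
   Formalization: The parameter $\alpha_G$ ranges over the rational numbers greater than 1. -}

module Defs where

open import Data.Nat as ℕ using (ℕ; zero; suc)
open import Data.Rational as ℚ using (ℚ; 0ℚ; 1ℚ; _+_; _*_; _≤_)
open import Data.Product using (_×_; _,_; ∃; Σ)
open import Data.List using (List; []; _∷_)
open import Relation.Binary.PropositionalEquality using (_≡_)

_^ℚ_ : ℚ → ℕ → ℚ
x ^ℚ zero  = 1ℚ
x ^ℚ suc e = x * (x ^ℚ e)

ℕ→ℚ : ℕ → ℚ
ℕ→ℚ m = Data.Integer.+ m ℚ./ 1
  where import Data.Integer

-- Vertices of the grid are pairs (row , column) of naturals; the grid has
-- side length m = √n, so a vertex (r , c) must satisfy r < m and c < m.
Vertex : Set
Vertex = ℕ × ℕ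

-- A path is described by the sequence of edges it uses, starting at s.
data Move : Set where
  U : Move   -- vertical edge (r , c) → (r - 1 , c)
  R : Move

data Path (m : ℕ) : Vertex → Vertex → List Move → Set where
  stop  : ∀ {r c} → r ℕ.< m → c ℕ.< m → Path m (r , c) (r , c) []
  up    : ∀ {r c t ms} → suc r ℕ.< m → c ℕ.< m →
          Path m (r , c) t ms → Path m (suc r , c) t (U ∷ ms)
  right : ∀ {r c t ms} → r ℕ.< m → suc c ℕ.< m →
          Path m (r , suc c) t ms → Path m (r , c) t (R ∷ ms)

weight : ℚ → ℕ → Vertex → List Move → ℚ
weight α m s [] = 0ℚ
weight α m (r , c) (U ∷ ms) = ((α * ℕ→ℚ m) ^ℚ (2 ℕ.* c)) + weight α m (ℕ.pred r , c) ms
weight α m (r , c) (R ∷ ms) = 1ℚ + weight α m (r , suc c) ms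

IsDist : ℚ → ℕ → Vertex → Vertex → ℚ → Set
IsDist α m s t d =
  (Σ (List Move) λ ms → Path m s t ms × weight α m s ms ≡ d) ×
  (∀ ms → Path m s t ms → d ≤ weight α m s ms)

IsShortest : ℚ → ℕ → Vertex → Vertex → List Move → Set
IsShortest α m s t ms = Path m s t ms × (∀ ms′ → Path m s t ms′ → weight α m s ms ≤ weight α m s ms′)

IsApproxSP : ℚ → ℚ → ℕ → Vertex → Vertex → List Move → Set
IsApproxSP β α m s t ms = Path m s t ms × (∀ d → IsDist α m s t d → weight α m s ms ≤ β * d)

-- Going up in column j costs (α√n)^(2j) per edge, so the s-t path that climbs all
-- i - k rows in column j and then steps right costs at most (i - k) (α√n)^(2j) + 1
-- ≤ √n (α√n)^(2j), whereas any other s-t path climbs at least once in column j + 1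
-- and so costs more than (α√n)^(2j+2), which exceeds α times the former.
{-# OPTIONS --safe #-}
module Submission where

open import Defs
import Data.Nat
open import Data.Nat as ℕ using (ℕ; zero; suc; _∸_; s≤s)
import Data.Nat.Properties as ℕₚ
import Data.Integer as ℤ
import Data.Integer.Properties as ℤₚ
open import Data.Rational using (ℚ; 0ℚ; 1ℚ; _+_; _*_; _≤_; _<_; toℚᵘ; nonNegative)
open import Data.Rational.Properties
import Data.Rational.Unnormalised as ℚᵘ
import Data.Rational.Unnormalised.Properties as ℚᵘₚ
open import Data.Product using (_×_; _,_; ∃₂; proj₂)
open import Data.Sum using (_⊎_; inj₁; inj₂)
open import Data.List using (List; _∷_; []; _++_; replicate)
open import Data.Empty using (⊥-elim)
open import Relation.Binary.PropositionalEquality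
open import Function using (case_of_)

p≤q+p : ∀ {p q} → 0ℚ ≤ q → p ≤ q + p
p≤q+p {p} {q} 0≤q = subst (_≤ q + p) (+-identityˡ p) (+-monoˡ-≤ p 0≤q)

p≤p+q : ∀ {p q} → 0ℚ ≤ q → p ≤ p + q
p≤p+q {p} {q} 0≤q = subst (_≤ p + q) (+-identityʳ p) (+-monoʳ-≤ p 0≤q)

p<1+p : ∀ p → p < 1ℚ + p
p<1+p p = subst (_< 1ℚ + p) (+-identityˡ p) (+-monoˡ-< p (positive⁻¹ 1ℚ))

p≤q*p : ∀ {p q} → 1ℚ ≤ q → 0ℚ ≤ p → p ≤ q * p
p≤q*p {p} {q} 1≤q 0≤p = subst (_≤ q * p) (*-identityˡ p) (*-monoʳ-≤-nonNeg p {{nonNegative 0≤p}} 1≤q)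

0≤1 : 0ℚ ≤ 1ℚ
0≤1 = <⇒≤ (positive⁻¹ 1ℚ)

^ℚ-nonNeg : ∀ {x} → 0ℚ ≤ x → ∀ e → 0ℚ ≤ x ^ℚ e
^ℚ-nonNeg 0≤x zero    = 0≤1
^ℚ-nonNeg {x} 0≤x (suc e) =
  nonNegative⁻¹ _ {{nonNeg*nonNeg⇒nonNeg x {{nonNegative 0≤x}} (x ^ℚ e) {{nonNegative (^ℚ-nonNeg 0≤x e)}}}}

1≤^ℚ : ∀ {x} → 1ℚ ≤ x → ∀ e → 1ℚ ≤ x ^ℚ e
1≤^ℚ 1≤x zero    = ≤-refl
1≤^ℚ 1≤x (suc e) = ≤-trans (1≤^ℚ 1≤x e) (p≤q*p 1≤x (^ℚ-nonNeg (≤-trans 0≤1 1≤x) e))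

ℕ→ℚ-+ : ∀ a b → ℕ→ℚ (a ℕ.+ b) ≡ ℕ→ℚ a + ℕ→ℚ b
ℕ→ℚ-+ a b = toℚᵘ-injective toℚᵘ-homo
  where
  _/1 : ℕ → ℚᵘ.ℚᵘ
  n /1 = ℚᵘ.mkℚᵘ (ℤ.+ n) 0

  numerators : ℤ.+ (a ℕ.+ b) ℤ.* ℤ.+ 1 ≡ (ℤ.+ a ℤ.* ℤ.+ 1 ℤ.+ ℤ.+ b ℤ.* ℤ.+ 1) ℤ.* ℤ.+ 1
  numerators = begin
    ℤ.+ (a ℕ.+ b) ℤ.* ℤ.+ 1                         ≡⟨ ℤₚ.*-identityʳ _ ⟩
    ℤ.+ (a ℕ.+ b)                                   ≡⟨ ℤₚ.pos-+ a b ⟩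
    ℤ.+ a ℤ.+ ℤ.+ b                                 ≡⟨ cong₂ ℤ._+_ (ℤₚ.*-identityʳ (ℤ.+ a)) (ℤₚ.*-identityʳ (ℤ.+ b)) ⟨
    ℤ.+ a ℤ.* ℤ.+ 1 ℤ.+ ℤ.+ b ℤ.* ℤ.+ 1             ≡⟨ ℤₚ.*-identityʳ _ ⟨
    (ℤ.+ a ℤ.* ℤ.+ 1 ℤ.+ ℤ.+ b ℤ.* ℤ.+ 1) ℤ.* ℤ.+ 1 ∎
    where open ≡-Reasoning

  toℚᵘ-homo : toℚᵘ (ℕ→ℚ (a ℕ.+ b)) ℚᵘ.≃ toℚᵘ (ℕ→ℚ a + ℕ→ℚ b)
  toℚᵘ-homo = begin
    toℚᵘ (ℕ→ℚ (a ℕ.+ b))           ≈⟨ toℚᵘ-fromℚᵘ ((a ℕ.+ b) /1) ⟩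
    (a ℕ.+ b) /1                   ≈⟨ ℚᵘ.*≡* numerators ⟩
    a /1 ℚᵘ.+ b /1                 ≈⟨ ℚᵘₚ.+-cong (ℚᵘₚ.≃-sym (toℚᵘ-fromℚᵘ (a /1))) (ℚᵘₚ.≃-sym (toℚᵘ-fromℚᵘ (b /1))) ⟩
    toℚᵘ (ℕ→ℚ a) ℚᵘ.+ toℚᵘ (ℕ→ℚ b) ≈⟨ toℚᵘ-homo-+ (ℕ→ℚ a) (ℕ→ℚ b) ⟨
    toℚᵘ (ℕ→ℚ a + ℕ→ℚ b)           ∎
    where open ℚᵘₚ.≃-Reasoning

ℕ→ℚ-suc-* : ∀ n x → x + ℕ→ℚ n * x ≡ ℕ→ℚ (suc n) * x
ℕ→ℚ-suc-* n x = begin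
  x + ℕ→ℚ n * x       ≡⟨ cong (_+ ℕ→ℚ n * x) (*-identityˡ x) ⟨
  1ℚ * x + ℕ→ℚ n * x  ≡⟨ *-distribʳ-+ x 1ℚ (ℕ→ℚ n) ⟨
  (1ℚ + ℕ→ℚ n) * x    ≡⟨ cong (_* x) (ℕ→ℚ-+ 1 n) ⟨
  ℕ→ℚ (suc n) * x     ∎
  where open ≡-Reasoning

ℕ→ℚ-nonNeg : ∀ n → 0ℚ ≤ ℕ→ℚ n
ℕ→ℚ-nonNeg n = nonNegative⁻¹ (ℕ→ℚ n) {{normalize-nonNeg n 1}}

ℕ→ℚ-mono-≤ : ∀ {a b} → a ℕ.≤ b → ℕ→ℚ a ≤ ℕ→ℚ b
ℕ→ℚ-mono-≤ {a} {b} a≤b = begin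
  ℕ→ℚ a                   ≤⟨ p≤q+p (ℕ→ℚ-nonNeg (b ∸ a)) ⟩
  ℕ→ℚ (b ∸ a) + ℕ→ℚ a     ≡⟨ ℕ→ℚ-+ (b ∸ a) a ⟨
  ℕ→ℚ (b ∸ a ℕ.+ a)       ≡⟨ cong ℕ→ℚ (ℕₚ.m∸n+n≡m a≤b) ⟩
  ℕ→ℚ b                   ∎
  where open ≤-Reasoning

ups-then-right : ℕ → List Move
ups-then-right n = replicate n U ++ R ∷ []

Path⇒column-≤ : ∀ {m r c r′ c′ ms} → Path m (r , c) (r′ , c′) ms → c ℕ.≤ c′
Path⇒column-≤ (stop _ _)    = ℕₚ.≤-refl
Path⇒column-≤ (up _ _ p)    = Path⇒column-≤ p
Path⇒column-≤ (right _ _ p) = ℕₚ.≤-trans (ℕₚ.n≤1+n _) (Path⇒column-≤ p)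

Path⇒row-≥ : ∀ {m r c r′ c′ ms} → Path m (r , c) (r′ , c′) ms → r′ ℕ.≤ r
Path⇒row-≥ (stop _ _)    = ℕₚ.≤-refl
Path⇒row-≥ (up _ _ p)    = ℕₚ.≤-trans (Path⇒row-≥ p) (ℕₚ.n≤1+n _)
Path⇒row-≥ (right _ _ p) = Path⇒row-≥ p

suc-∸ : ∀ {r k} → k ℕ.≤ r → suc r ∸ k ≡ suc (r ∸ k)
suc-∸ = ℕₚ.+-∸-assoc 1

Path-sameColumn⇒vertical : ∀ {m r c k ms} → Path m (r , c) (k , c) ms → ms ≡ replicate (r ∸ k) U
Path-sameColumn⇒vertical {r = r} (stop _ _) rewrite ℕₚ.n∸n≡0 r = refl
Path-sameColumn⇒vertical (up _ _ p) rewrite suc-∸ (Path⇒row-≥ p) = cong (U ∷_) (Path-sameColumn⇒vertical p)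
Path-sameColumn⇒vertical (right _ _ p) = ⊥-elim (ℕₚ.<-irrefl refl (Path⇒column-≤ p))

Path-nextColumn : ∀ {m r j k ms} → Path m (r , j) (k , suc j) ms →
                  ms ≡ ups-then-right (r ∸ k) ⊎ ∃₂ λ a b → ms ≡ replicate a U ++ R ∷ U ∷ replicate b U
Path-nextColumn (up _ _ p) with Path-nextColumn p
... | inj₁ eq rewrite suc-∸ (Path⇒row-≥ p) = inj₁ (cong (U ∷_) eq)
... | inj₂ (a , b , eq)                    = inj₂ (suc a , b , cong (U ∷_) eq)
Path-nextColumn (right {r} {t = k , _} _ _ p) with r ∸ k | Path-sameColumn⇒vertical p
... | zero  | refl = inj₁ refl
... | suc b | refl = inj₂ (0 , b , refl)

canonical-Path : ∀ {m i j k} → k ℕ.≤ i → i ℕ.< m → suc j ℕ.< m →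
                 Path m (i , j) (k , suc j) (ups-then-right (i ∸ k))
canonical-Path {m} {i} {j} {k} k≤i i<m 1+j<m =
  subst (λ r → Path m (r , j) (k , suc j) (ups-then-right (i ∸ k))) n+k≡i
        (climb (i ∸ k) (subst (ℕ._< m) (sym n+k≡i) i<m))
  where
  n+k≡i : i ∸ k ℕ.+ k ≡ i
  n+k≡i = ℕₚ.m∸n+n≡m k≤i

  climb : ∀ n → n ℕ.+ k ℕ.< m → Path m (n ℕ.+ k , j) (k , suc j) (ups-then-right n)
  climb zero    k<m   = right k<m 1+j<m (stop k<m 1+j<m)
  climb (suc n) n+k<m = up n+k<m (ℕₚ.<-trans (ℕₚ.n<1+n _) 1+j<m) (climb n (ℕₚ.<-trans (ℕₚ.n<1+n _) n+k<m))

module _ (α : ℚ) (m : ℕ) where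

  private
    X : ℚ
    X = α * ℕ→ℚ m

  weight-nonNeg : 0ℚ ≤ X → ∀ s ms → 0ℚ ≤ weight α m s ms
  weight-nonNeg 0≤X s       []       = ≤-refl
  weight-nonNeg 0≤X (r , c) (U ∷ ms) = ≤-trans (weight-nonNeg 0≤X _ ms) (p≤q+p (^ℚ-nonNeg 0≤X (2 ℕ.* c)))
  weight-nonNeg 0≤X (r , c) (R ∷ ms) = ≤-trans (weight-nonNeg 0≤X _ ms) (p≤q+p 0≤1)

  weight-ups-then-right : ∀ r j n → weight α m (r , j) (ups-then-right n) ≡ ℕ→ℚ n * X ^ℚ (2 ℕ.* j) + 1ℚ
  weight-ups-then-right r j zero = begin
    1ℚ + 0ℚ                  ≡⟨ +-identityʳ 1ℚ ⟩
    1ℚ                       ≡⟨ +-identityˡ 1ℚ ⟨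
    0ℚ + 1ℚ                  ≡⟨ cong (_+ 1ℚ) (*-zeroˡ (X ^ℚ (2 ℕ.* j))) ⟨
    0ℚ * X ^ℚ (2 ℕ.* j) + 1ℚ ∎
    where open ≡-Reasoning
  weight-ups-then-right r j (suc n) = begin
    W + weight α m (ℕ.pred r , j) (ups-then-right n) ≡⟨ cong (W +_) (weight-ups-then-right (ℕ.pred r) j n) ⟩
    W + (ℕ→ℚ n * W + 1ℚ)                          ≡⟨ +-assoc W (ℕ→ℚ n * W) 1ℚ ⟨
    (W + ℕ→ℚ n * W) + 1ℚ                          ≡⟨ cong (_+ 1ℚ) (ℕ→ℚ-suc-* n W) ⟩
    ℕ→ℚ (suc n) * W + 1ℚ                          ∎
    where
    open ≡-Reasoning
    W = X ^ℚ (2 ℕ.* j)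

  weight-detour-≥ : 0ℚ ≤ X → ∀ r j a b →
                    1ℚ + X ^ℚ (2 ℕ.* suc j) ≤ weight α m (r , j) (replicate a U ++ R ∷ U ∷ replicate b U)
  weight-detour-≥ 0≤X r j zero b =
    +-monoʳ-≤ 1ℚ (p≤p+q {X ^ℚ (2 ℕ.* suc j)} (weight-nonNeg 0≤X (ℕ.pred r , suc j) (replicate b U)))
  weight-detour-≥ 0≤X r j (suc a) b =
    ≤-trans (weight-detour-≥ 0≤X (ℕ.pred r) j a b) (p≤q+p (^ℚ-nonNeg 0≤X (2 ℕ.* j)))

  1≤scale : 1ℚ ≤ α → 0 ℕ.< m → 1ℚ ≤ X
  1≤scale 1≤α 0<m = ≤-trans 1≤m (p≤q*p 1≤α (≤-trans 0≤1 1≤m))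
    where
    1≤m : 1ℚ ≤ ℕ→ℚ m
    1≤m = ℕ→ℚ-mono-≤ 0<m

  α*canonical-weight≤vertical-edge : ∀ {j n} → 1ℚ ≤ α → suc n ℕ.≤ m →
                                     α * (ℕ→ℚ n * X ^ℚ (2 ℕ.* j) + 1ℚ) ≤ X ^ℚ (2 ℕ.* suc j)
  α*canonical-weight≤vertical-edge {j} {n} 1≤α 1+n≤m = begin
    α * (ℕ→ℚ n * W + 1ℚ)   ≤⟨ *-monoˡ-≤-nonNeg α {{α≥0}} (+-monoʳ-≤ (ℕ→ℚ n * W) (1≤^ℚ 1≤X (2 ℕ.* j))) ⟩
    α * (ℕ→ℚ n * W + W)    ≡⟨ cong (α *_) (trans (+-comm (ℕ→ℚ n * W) W) (ℕ→ℚ-suc-* n W)) ⟩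
    α * (ℕ→ℚ (suc n) * W)  ≤⟨ *-monoˡ-≤-nonNeg α {{α≥0}} (*-monoʳ-≤-nonNeg W {{W≥0}} (ℕ→ℚ-mono-≤ 1+n≤m)) ⟩
    α * (ℕ→ℚ m * W)        ≡⟨ *-assoc α (ℕ→ℚ m) W ⟨
    X * W                  ≤⟨ p≤q*p 1≤X (≤-trans 0≤1 (1≤^ℚ 1≤X (suc (2 ℕ.* j)))) ⟩
    X * (X * W)            ≡⟨ cong (X ^ℚ_) (ℕₚ.*-suc 2 j) ⟨
    X ^ℚ (2 ℕ.* suc j)     ∎
    where
    open ≤-Reasoning
    W = X ^ℚ (2 ℕ.* j)
    1≤X = 1≤scale 1≤α (ℕₚ.<-≤-trans (s≤s ℕ.z≤n) 1+n≤m)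
    α≥0 = nonNegative (≤-trans 0≤1 1≤α)
    W≥0 = nonNegative (^ℚ-nonNeg (≤-trans 0≤1 1≤X) (2 ℕ.* j))

Path-canonical-or-heavier : ∀ {α m i j k ms} → 1ℚ ≤ α → i ℕ.< m → Path m (i , j) (k , suc j) ms →
                            ms ≡ ups-then-right (i ∸ k) ⊎
                            α * weight α m (i , j) (ups-then-right (i ∸ k)) < weight α m (i , j) ms
Path-canonical-or-heavier {α} {m} {i} {j} {k} {ms} 1≤α i<m p with Path-nextColumn p
... | inj₁ eq             = inj₁ eq
... | inj₂ (a , b , refl) = inj₂ (begin-strict
  α * weight α m (i , j) (ups-then-right n) ≡⟨ cong (α *_) (weight-ups-then-right α m i j n) ⟩
  α * (ℕ→ℚ n * X ^ℚ (2 ℕ.* j) + 1ℚ)          ≤⟨ α*canonical-weight≤vertical-edge α m {j} 1≤α 1+n≤m ⟩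
  X ^ℚ (2 ℕ.* suc j)                         <⟨ p<1+p _ ⟩
  1ℚ + X ^ℚ (2 ℕ.* suc j)                    ≤⟨ weight-detour-≥ α m 0≤X i j a b ⟩
  weight α m (i , j) ms                      ∎)
  where
  open ≤-Reasoning
  n = i ∸ k
  X = α * ℕ→ℚ m
  1+n≤m = ℕₚ.≤-trans (s≤s (ℕₚ.m∸n≤m i k)) i<m
  0≤X = ≤-trans 0≤1 (1≤scale α m 1≤α (ℕₚ.≤-<-trans ℕ.z≤n i<m))

lemma5p2 : (α : ℚ) → 1ℚ Data.Rational.< α → (m i j k : ℕ) →
    i Data.Nat.< m → suc j Data.Nat.< m → k Data.Nat.< i →
    IsShortest α m (i , j) (k , suc j) (replicate (i ∸ k) U ++ (R ∷ [])) ×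
    IsApproxSP α α m (i , j) (k , suc j) (replicate (i ∸ k) U ++ (R ∷ [])) ×
    (∀ ms → IsApproxSP α α m (i , j) (k , suc j) ms → ms ≡ replicate (i ∸ k) U ++ (R ∷ []))
lemma5p2 α 1<α m i j k i<m 1+j<m k<i = shortest , approximate , unique
  where
  1≤α = <⇒≤ 1<α
  path = canonical-Path (ℕₚ.<⇒≤ k<i) i<m 1+j<m
  canonical = ups-then-right (i ∸ k)
  c = weight α m (i , j) canonical

  ≤α* : ∀ ms → weight α m (i , j) ms ≤ α * weight α m (i , j) ms
  ≤α* ms = p≤q*p 1≤α (weight-nonNeg α m 0≤X (i , j) ms)
    where 0≤X = ≤-trans 0≤1 (1≤scale α m 1≤α (ℕₚ.≤-<-trans ℕ.z≤n i<m))

  shortest : IsShortest α m (i , j) (k , suc j) canonical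
  shortest = path , λ ms p → case Path-canonical-or-heavier 1≤α i<m p of λ where
    (inj₁ refl)  → ≤-refl
    (inj₂ αc<w) → ≤-trans (≤α* canonical) (<⇒≤ αc<w)

  distance : IsDist α m (i , j) (k , suc j) c
  distance = (canonical , path , refl) , proj₂ shortest

  approximate : IsApproxSP α α m (i , j) (k , suc j) canonical
  approximate = path , λ where
    _ ((ms , p , refl) , _) → ≤-trans (proj₂ shortest ms p) (≤α* ms)

  unique : ∀ ms → IsApproxSP α α m (i , j) (k , suc j) ms → ms ≡ canonical
  unique ms (p , w≤α*dist) with Path-canonical-or-heavier 1≤α i<m p
  ... | inj₁ eq   = eq
  ... | inj₂ αc<w = ⊥-elim (<-irrefl refl (≤-<-trans (w≤α*dist c distance) αc<w))
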